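{- Let $M$ and $M'$ be $n$-layered models over a signature $\Delta^n$ and let $S=(S_k)_{k\in\{0,\dots,n\}}$ be an $n$-layered simulation from $M$ to $M'$. Then for every $k\in\{0,\dots,n\}$, every $(w_0,\dots,w_k)$ and $(w'_0,\dots,w'_k)$ with $(w_0,\dots,w_k)S_k(w'_0,\dots,w'_k)$, and every $\varphi\in SFm^+(k,\Delta^n)$, \[M_k,w_0,\dots,w_k\models_k\varphi\quad\text{implies}\quad M'_k,w'_0,\dots,w'_k\models_k\varphi.\]
   Context: Notation. For $P\subseteq S_0\times\dots\times S_n$ and $k\le n$, $P|_k\subseteq S_0\times\dots\times S_k$ is the set of $(s_0,\dots,s_k)$ such that $(s_0,\dots,s_n)\in P$ for some $s_{k+1},\dots,s_n$. Signatures. An $n$-layered signature $\Delta^n=(\mathrm{Prop}_k,\mathrm{Nom}_k)_{k\in\{0,\dots,n\}}$ is a family of pairwise disjoint, possibly empty, sets of propositions $p_k\in\mathrm{Prop}_k$ and nominals $i_k\in\mathrm{Nom}_k$. Positive strict formulas. For $k\in\{0,\dots,n\}$, $SFm^+(k,\Delta^n)$ is the set of formulas generated by $\varphi::= p_k\mid i_k\mid\varphi\wedge\varphi\mid @_{i_k}\varphi\mid\Diamond_k\varphi$ with $p_k\in\mathrm{Prop}_k$, $i_k\in\mathrm{Nom}_k$ (no negation). Models. An $n$-layered model $M=(W^n,D^n,R^n,V^n)$ over $\Delta^n$ consists of: pairwise disjoint sets $W_0,\dots,W_n$; a predicate $D^n\subseteq W_0\times\dots\times W_n$ such that, writing $D_k=D^n|_k$,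 for each $k$, $W_k=\{v_k\mid (w_0,\dots,w_{k-1},v_k)\in D_k\text{ for some }(w_0,\dots,w_{k-1})\in D_{k-1}\}$; relations $R_k\subseteq D_k\times D_k$ ($k\le n$); valuations $V^{\mathrm{Prop}}_0:\mathrm{Prop}_0\to\mathcal P(W_0)$, $V^{\mathrm{Prop}}_k:\mathrm{Prop}_k\times D_{k-1}\to\mathcal P(W_k)$ for $k\ge1$, and $V^{\mathrm{Nom}}_k:\mathrm{Nom}_k\to W_k$. The $k$-restriction $M_k$ keeps only the components of levels $\le k$ (with $D_k$ in place of $D^n$). Primed symbols denote the components of $M'$. Satisfaction. For $(w_0,\dots,w_k)\in D_k$: - $p_k$: holds iff $w_0\in V^{\mathrm{Prop}}_0(p_0)$ when $k=0$, and iff $w_k\in V^{\mathrm{Prop}}_k(p_k,(w_0,\dots,w_{k-1}))$ when $k\ge1$; - $i_k$: iff $w_k=V^{\mathrm{Nom}}_k(i_k)$ and $(w_0,\dots,w_{k-1},V^{\mathrm{Nom}}_k(i_k))\in D_k$; - $\wedge$: as usual; - $@_{i_k}\varphi$: iff $(w_0,\dots,w_{k-1},V^{\mathrm{Nom}}_k(i_k))\in D_k$ and $M_k,w_0,\dots,w_{k-1},V^{\mathrm{Nom}}_k(i_k)\models_k\varphi$; - $\Diamond_k\varphi$: iff there is $(v_0,\dots,v_k)$ with $(w_0,\dots,w_k)R_k(v_0,\dots,v_k)$ and $M_k,v_0,\dots,v_k\models_k\varphi$. $n$-layered simulation. A family $S=(S_k\subseteq D_k\times D'_k)_{k\in\{0,\dots,n\}}$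 is an $n$-layered simulation from $M$ to $M'$ if for every $k$ and every $(w_0,\dots,w_k)S_k(w'_0,\dots,w'_k)$: (ATOM$_k$) 1. for each $p_k\in\mathrm{Prop}_k$: if $k=0$, $w_0\in V^{\mathrm{Prop}}_0(p_0)$ implies $w'_0\in V'^{\mathrm{Prop}}_0(p_0)$; if $k\ge1$, $w_k\in V^{\mathrm{Prop}}_k(p_k,(w_0,\dots,w_{k-1}))$ implies $w'_k\in V'^{\mathrm{Prop}}_k(p_k,(w'_0,\dots,w'_{k-1}))$. 2. for each $i_k\in\mathrm{Nom}_k$: (i) if $k=0$, $V^{\mathrm{Nom}}_0(i_0)\,S_0\,V'^{\mathrm{Nom}}_0(i_0)$; if $k\ge1$, $(w_0,\dots,w_{k-1},V^{\mathrm{Nom}}_k(i_k))\,S_k\,(w'_0,\dots,w'_{k-1},V'^{\mathrm{Nom}}_k(i_k))$; (ii) [$w_k=V^{\mathrm{Nom}}_k(i_k)$ and $(w_0,\dots,w_{k-1},V^{\mathrm{Nom}}_k(i_k))\in D_k$] implies [$w'_k=V'^{\mathrm{Nom}}_k(i_k)$ and $(w'_0,\dots,w'_{k-1},V'^{\mathrm{Nom}}_k(i_k))\in D'_k$]. (ZIG$_k$) for all $(v_0,\dots,v_k)$ with $(w_0,\dots,w_k)R_k(v_0,\dots,v_k)$ there is $(v'_0,\dots,v'_k)$ with $(w'_0,\dots,w'_k)R'_k(v'_0,\dots,v'_k)$ and $(v_0,\dots,v_k)S_k(v'_0,\dots,v'_k)$. -}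

module Defs where

open import Data.Nat using (ℕ; zero; suc; _≤_)
open import Data.Product using (Σ; _×_; _,_; ∃)
open import Relation.Binary.PropositionalEquality using (_≡_)

Tup : (ℕ → Set) → ℕ → Set
Tup W zero    = W zero
Tup W (suc k) = Tup W k × W (suc k)

last : (W : ℕ → Set) {k : ℕ} → Tup W k → W k
last W {zero}  w       = w
last W {suc k} (t , w) = w

setLast : (W : ℕ → Set) {k : ℕ} → Tup W k → W k → Tup W k
setLast W {zero}  _       v = v
setLast W {suc k} (t , _) v = (t , v)

data Prefix (W : ℕ → Set) (k : ℕ) (t : Tup W k) : (m : ℕ) → Tup W m → Set where
  here  : Prefix W k t k t
  there : {m : ℕ} {u : Tup W m} {w : W (suc m)} → Prefix W k t m u → Prefix W k t (suc m) (u , w)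

Restr : (W : ℕ → Set) (n : ℕ) → (Tup W n → Set) → (k : ℕ) → Tup W k → Set
Restr W n P k t = Σ (Tup W n) λ u → P u × Prefix W k t n u

-- Layered signature: propositions and nominals per level (disjoint by typing)
record Signature : Set₁ where
  field
    PropSym : ℕ → Set
    NomSym  : ℕ → Set
open Signature public

-- the covering condition W_k = { v | (w₀,…,w_{k-1},v) ∈ D_k, (w₀,…,w_{k-1}) ∈ D_{k-1} }
Cover : (W : ℕ → Set) (n : ℕ) → (Tup W n → Set) → ℕ → Set
Cover W n D zero    = (v : W zero) → Restr W n D zero v
Cover W n D (suc k) = (v : W (suc k)) → Σ (Tup W k) λ t → Restr W n D k t × Restr W n D (suc k) (t , v)

record Model (n : ℕ) (Δ : Signature) : Set₁ where
  field
    W      : ℕ → Set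
    D      : Tup W n → Set
    cover  : (k : ℕ) → k ≤ n → Cover W n D k
    R      : (k : ℕ) → Tup W k → Tup W k → Set
    R-dom  : (k : ℕ) → k ≤ n → {t u : Tup W k} → R k t u → Restr W n D k t × Restr W n D k u
    VProp₀ : PropSym Δ zero → W zero → Set
    VPropₛ : (k : ℕ) → PropSym Δ (suc k) → Tup W k → W (suc k) → Set
    VNom   : (k : ℕ) → NomSym Δ k → W k

  Dk : (k : ℕ) → Tup W k → Set
  Dk = Restr W n D

  PropHolds : (k : ℕ) → PropSym Δ k → Tup W k → Set
  PropHolds zero    p w       = VProp₀ p w
  PropHolds (suc k) p (t , w) = VPropₛ k p t w

open Model public

data SFm⁺ (Δ : Signature) (k : ℕ) : Set where
  prop : PropSym Δ k → SFm⁺ Δ k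
  nom  : NomSym Δ k → SFm⁺ Δ k
  _∧_  : SFm⁺ Δ k → SFm⁺ Δ k → SFm⁺ Δ k
  at   : NomSym Δ k → SFm⁺ Δ k → SFm⁺ Δ k
  ◇    : SFm⁺ Δ k → SFm⁺ Δ k

Sat : {n : ℕ} {Δ : Signature} (M : Model n Δ) {k : ℕ} → Tup (W M) k → SFm⁺ Δ k → Set
Sat M {k} t (prop p) = PropHolds M k p t
Sat M {k} t (nom i)  = last (W M) t ≡ VNom M k i × Dk M k (setLast (W M) t (VNom M k i))
Sat M t (φ ∧ ψ)      = Sat M t φ × Sat M t ψ
Sat M {k} t (at i φ) = Dk M k (setLast (W M) t (VNom M k i)) × Sat M (setLast (W M) t (VNom M k i)) φ
Sat M {k} t (◇ φ)    = Σ (Tup (W M) k) λ u → R M k t u × Sat M u φ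

record Simulation {n : ℕ} {Δ : Signature} (M M' : Model n Δ) : Set₁ where
  field
    S      : (k : ℕ) → Tup (W M) k → Tup (W M') k → Set
    S-dom  : (k : ℕ) → k ≤ n → {t : Tup (W M) k} {t' : Tup (W M') k} →
             S k t t' → Dk M k t × Dk M' k t'
    atom-prop : (k : ℕ) → k ≤ n → {t : Tup (W M) k} {t' : Tup (W M') k} → S k t t' →
             (p : PropSym Δ k) → PropHolds M k p t → PropHolds M' k p t'
    atom-nom-i : (k : ℕ) → k ≤ n → {t : Tup (W M) k} {t' : Tup (W M') k} → S k t t' →
             (i : NomSym Δ k) → S k (setLast (W M) t (VNom M k i)) (setLast (W M') t' (VNom M' k i))
    atom-nom-ii : (k : ℕ) → k ≤ n → {t : Tup (W M) k} {t' : Tup (W M') k} → S k t t' →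
             (i : NomSym Δ k) →
             (last (W M) t ≡ VNom M k i × Dk M k (setLast (W M) t (VNom M k i))) →
             (last (W M') t' ≡ VNom M' k i × Dk M' k (setLast (W M') t' (VNom M' k i)))
    zig    : (k : ℕ) → k ≤ n → {t : Tup (W M) k} {t' : Tup (W M') k} → S k t t' →
             (u : Tup (W M) k) → R M k t u →
             Σ (Tup (W M') k) λ u' → R M' k t' u' × S k u u'
open Simulation public

module Submission where

open import Defs
open import Data.Nat using (ℕ; _≤_)
open import Data.Product using (_,_; proj₂)

module _ {n : ℕ} {Δ : Signature} {M M' : Model n Δ} (Sim : Simulation M M')
         {k : ℕ} (k≤n : k ≤ n) where

  Sat-preserved : {t : Tup (W M) k} {t' : Tup (W M') k} → S Sim k t t' →
                  (φ : SFm⁺ Δ k) → Sat M t φ → Sat M' t' φ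
  Sat-preserved s (prop p) holds = atom-prop Sim k k≤n s p holds
  Sat-preserved s (nom i) holds = atom-nom-ii Sim k k≤n s i holds
  Sat-preserved s (φ ∧ ψ) (holds-φ , holds-ψ) =
    Sat-preserved s φ holds-φ , Sat-preserved s ψ holds-ψ
  -- The target-side D′ₖ-membership required by @ᵢ comes from S landing in D′ₖ.
  Sat-preserved s (at i φ) (_ , holds) =
    proj₂ (S-dom Sim k k≤n s-at-i) , Sat-preserved s-at-i φ holds
    where s-at-i = atom-nom-i Sim k k≤n s i
  Sat-preserved s (◇ φ) (u , tRu , holds) with zig Sim k k≤n s u tRu
  ... | u' , t'R'u' , s-u = u' , t'R'u' , Sat-preserved s-u φ holds

theorem3 : {n : ℕ} {Δ : Signature} (M M' : Model n Δ) (Sim : Simulation M M') →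
    (k : ℕ) → k ≤ n → (t : Tup (W M) k) (t' : Tup (W M') k) → S Sim k t t' →
    (φ : SFm⁺ Δ k) → Sat M t φ → Sat M' t' φ
theorem3 M M' Sim k k≤n t t' = Sat-preserved Sim k≤n
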